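{- Let $p$ be a prime and $X_1,\dots,X_6\in\mathbb{P}^2(\mathbb{F}_p)$ with $X_1,\dots,X_4$ in general position, $X_5\ne X_6$, and the line $\ell=X_5X_6$ containing none of $X_1,\dots,X_4$. Suppose $X_i=[x_i:y_i:z_i]$ for $1\le i\le6$ with $x_i,y_i,z_i\in\mathbb{Z}$ (reduced mod $p$). Identify $\ell$ with $\mathbb{P}^1(\mathbb{F}_p)$ by sending $X_1X_2\cap\ell\mapsto[1:0]$, $X_1X_3\cap\ell\mapsto[0:1]$, $X_2X_3\cap\ell\mapsto[1:1]$. Then under this identification $X_5$ corresponds to $[r:s]$ for some integers $r,s$ with $|r|,|s|=O\big(\max\{|x_i|,|y_i|,|z_i|\colon1\le i\le6\}^6\big)$, with an absolute implied constant.
   Context: $PQ$ denotes the line through distinct points $P,Q$ of the projective plane. -}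

module Defs where

open import Data.Integer using (ℤ; +_; _-_; _*_; _+_; ∣_∣)
open import Data.Integer.Divisibility using (_∣_)
open import Data.Nat using (ℕ; _⊔_)
open import Data.Product using (_×_; _,_; ∃; ∃-syntax)
open import Relation.Nullary using (¬_)

-- Vectors over ℤ, read modulo p (i.e. as vectors over 𝔽_p)
V3 : Set
V3 = ℤ × ℤ × ℤ

V2 : Set
V2 = ℤ × ℤ

_≡_[mod_] : ℤ → ℤ → ℕ → Set
a ≡ b [mod p ] = (+ p) ∣ (a - b)

Unit : ℕ → ℤ → Set
Unit p c = ¬ (c ≡ + 0 [mod p ])

_·₃_ : ℤ → V3 → V3
c ·₃ (a , b , d) = (c * a , c * b , c * d)

_+₃_ : V3 → V3 → V3
(a , b , c) +₃ (a' , b' , c') = (a + a' , b + b' , c + c')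

_·₂_ : ℤ → V2 → V2
c ·₂ (a , b) = (c * a , c * b)

Eq3 : ℕ → V3 → V3 → Set
Eq3 p (a , b , c) (a' , b' , c') = (a ≡ a' [mod p ]) × (b ≡ b' [mod p ]) × (c ≡ c' [mod p ])

Eq2 : ℕ → V2 → V2 → Set
Eq2 p (a , b) (a' , b') = (a ≡ a' [mod p ]) × (b ≡ b' [mod p ])

zero₃ : V3
zero₃ = (+ 0 , + 0 , + 0)

zero₂ : V2
zero₂ = (+ 0 , + 0)

Nonzero3 : ℕ → V3 → Set
Nonzero3 p v = ¬ Eq3 p v zero₃

SameP2 : ℕ → V3 → V3 → Set
SameP2 p u v = ∃[ c ] (Unit p c × Eq3 p u (c ·₃ v))

SameP1 : ℕ → V2 → V2 → Set
SameP1 p u v = ∃[ c ] (Unit p c × Eq2 p u (c ·₂ v))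

Collinear : ℕ → V3 → V3 → V3 → Set
Collinear p u v w =
  ∃[ a ] ∃[ b ] ∃[ c ] (¬ ((a ≡ + 0 [mod p ]) × (b ≡ + 0 [mod p ]) × (c ≡ + 0 [mod p ]))
    × Eq3 p ((a ·₃ u) +₃ ((b ·₃ v) +₃ (c ·₃ w))) zero₃)

GeneralPosition : ℕ → V3 → V3 → V3 → V3 → Set
GeneralPosition p a b c d =
  ¬ Collinear p a b c × ¬ Collinear p a b d × ¬ Collinear p a c d × ¬ Collinear p b c d

OnLine : ℕ → V3 → V3 → V3 → Set
OnLine p P Q w = ∃[ a ] ∃[ b ] Eq3 p w ((a ·₃ P) +₃ (b ·₃ Q))

-- a linear map 𝔽_p³ → 𝔽_p², given by its two rows
Mat23 : Set
Mat23 = V3 × V3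

dot : V3 → V3 → ℤ
dot (a , b , c) (a' , b' , c') = a * a' + (b * b' + c * c')

apply : Mat23 → V3 → V2
apply (r₁ , r₂) v = (dot r₁ v , dot r₂ v)

-- L is injective on the 2-dimensional subspace underlying the line PQ,
-- hence induces a projective isomorphism  PQ ≅ ℙ¹(𝔽_p)
InjOnLine : ℕ → Mat23 → V3 → V3 → Set
InjOnLine p L P Q = ∀ w → OnLine p P Q w → Eq2 p (apply L w) zero₂ → Eq3 p w zero₃

SendsMeet : ℕ → Mat23 → V3 → V3 → V3 → V3 → V2 → Set
SendsMeet p L A B P Q t =
  ∀ w → Nonzero3 p w → OnLine p A B w → OnLine p P Q w → SameP1 p (apply L w) t

Identification : ℕ → Mat23 → V3 → V3 → V3 → V3 → V3 → Set
Identification p L X₁ X₂ X₃ X₅ X₆ =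
  InjOnLine p L X₅ X₆
  × SendsMeet p L X₁ X₂ X₅ X₆ (+ 1 , + 0)
  × SendsMeet p L X₁ X₃ X₅ X₆ (+ 0 , + 1)
  × SendsMeet p L X₂ X₃ X₅ X₆ (+ 1 , + 1)

absMax3 : V3 → ℕ
absMax3 (a , b , c) = ∣ a ∣ ⊔ (∣ b ∣ ⊔ ∣ c ∣)

absMax6 : V3 → V3 → V3 → V3 → V3 → V3 → ℕ
absMax6 a b c d e f =
  absMax3 a ⊔ (absMax3 b ⊔ (absMax3 c ⊔ (absMax3 d ⊔ (absMax3 e ⊔ absMax3 f))))

{-# OPTIONS --safe #-}
module Submission where

-- Let P = X₅ and Q = X₆ span ℓ. The linear forms det X₁ X₃ and det X₁ X₂ vanish at X₁X₃ ∩ ℓ and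
-- X₁X₂ ∩ ℓ. Weighted by det P Q X₂ and det P Q X₃, their difference is a form vanishing on X₂X₃
-- minus det X₁ X₂ X₃ · det P Q, so they agree at X₂X₃ ∩ ℓ, and the map L₀ with these two rows
-- realises the identification ℓ ≅ ℙ¹. Any other identification L is proportional to L₀ on ℓ: the
-- three conditions at the meets are linear in L P and L Q, and two Plücker relations eliminate
-- L Q from them. Hence X₅ corresponds to [det P Q X₂ · det X₁ X₃ P : det P Q X₃ · det X₁ X₂ P],
-- and each coordinate, a product of two 3 × 3 determinants, is at most (6 M³)² = 36 M⁶.
-- Everything is computed with integer representatives, a congruence modulo p standing for an
-- equation over 𝔽_p.

open import Defs

module Geometry where

  open import Data.Empty using (⊥-elim)
  open import Data.Integer using (ℤ; +_; -[1+_]; _+_; _-_; _*_; -_) renaming (∣_∣ to abs)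
  open import Data.Integer.Divisibility.Signed
    using (_∣_; divides; _∣?_; ∣ᵤ⇒∣; ∣⇒∣ᵤ; ∣m∣n⇒∣m+n; ∣m∣n⇒∣m-n; ∣m+n∣n⇒∣m; ∣n⇒∣m*n; ∣m⇒∣m*n; ∣m⇒∣-m)
  import Data.Integer.Properties as ℤ
  import Data.Integer.Tactic.RingSolver as ℤ-RingSolver
  open import Data.Integer.Tactic.RingSolver using (solve; solve-∀)
  open import Data.List using (_∷_; [])
  import Data.Nat as ℕ
  open import Data.Nat using (ℕ; suc)
  open import Data.Nat.Coprimality using (Coprime; coprime-Bézout)
  open import Data.Nat.Divisibility using (∣1⇒≡1) renaming (_∣_ to _∣ℕ_)
  open import Data.Nat.GCD using (module Bézout)
  open import Data.Nat.Primality using (Prime; euclidsLemma; prime⇒irreducible; ¬prime[1])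
  open import Data.Product using (_×_; _,_; proj₁; proj₂; map₂; ∃-syntax)
  open import Data.Sum using (inj₁; inj₂)
  open import Function using (_∘_)
  open import Relation.Binary.PropositionalEquality
    using (_≡_; refl; sym; trans; cong; cong₂; subst; module ≡-Reasoning)
  open import Relation.Nullary using (¬_; Dec; yes; no)
  open import Tactic.RingSolver.NonReflective ℤ-RingSolver.ring
    using (Expr; Κ; _⊕_; _⊗_; ⊝_; _⊜_) renaming (solve to solveExpr)

  -- Vector operations over an arbitrary ring signature (the primed ones are those of Defs): at ℤ
  -- they are the geometry, at the solver's syntax E they restate the identities below for solveExpr.
  module VectorAlgebra {A : Set} (add mul : A → A → A) (neg : A → A) where

    infixl 6 _⊹_ _−_
    infixl 7 _⋆_

    _⊹_ _−_ _⋆_ : A → A → A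
    x ⊹ y = add x y
    x − y = add x (neg y)
    x ⋆ y = mul x y

    dot′ : A × A × A → A × A × A → A
    dot′ (a , b , c) (a′ , b′ , c′) = a ⋆ a′ ⊹ (b ⋆ b′ ⊹ c ⋆ c′)

    _·₃′_ : A → A × A × A → A × A × A
    k ·₃′ (a , b , c) = (k ⋆ a , k ⋆ b , k ⋆ c)

    _+₃′_ _-₃_ : A × A × A → A × A × A → A × A × A
    (a , b , c) +₃′ (a′ , b′ , c′) = (a ⊹ a′ , b ⊹ b′ , c ⊹ c′)
    (a , b , c) -₃ (a′ , b′ , c′) = (a − a′ , b − b′ , c − c′)

    cross : A × A × A → A × A × A → A × A × A
    cross (a₁ , a₂ , a₃) (b₁ , b₂ , b₃) = (a₂ ⋆ b₃ − a₃ ⋆ b₂ , a₃ ⋆ b₁ − a₁ ⋆ b₃ , a₁ ⋆ b₂ − a₂ ⋆ b₁)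

    det : A × A × A → A × A × A → A × A × A → A
    det u v w = dot′ (cross u v) w

    -- the point of PQ on which the form det a b vanishes, i.e. ab ∩ PQ
    meet : A × A × A → A × A × A → A × A × A → A × A × A → A × A × A
    meet P Q a b = (det a b Q ·₃′ P) +₃′ (neg (det a b P) ·₃′ Q)

    -- vanishes at b and c, and differs from (det P Q b) det a c − (det P Q c) det a b by
    -- (det a b c) det P Q
    frameForm : A × A × A → A × A × A → A × A × A → A × A × A → A × A × A → A × A × A
    frameForm a b c P Q = (det P Q b ·₃′ cross a c) +₃′ ((neg (det P Q c) ·₃′ cross a b) +₃′ (det a b c ·₃′ cross P Q))

    _·₂′_ : A → A × A → A × A
    k ·₂′ (a , b) = (k ⋆ a , k ⋆ b)

    _+₂_ : A × A → A × A → A × A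
    (a , b) +₂ (a′ , b′) = (a ⊹ a′ , b ⊹ b′)

    det₂ : A × A → A × A → A
    det₂ (x , y) (r , s) = x ⋆ s − y ⋆ r

  open VectorAlgebra _+_ _*_ -_ public using (cross; det; _-₃_; meet; frameForm; _+₂_; det₂)
  module E {n : ℕ} = VectorAlgebra {Expr ℤ n} _⊕_ _⊗_ ⊝_

  ≡-triple : ∀ {a b c a′ b′ c′ : ℤ} → a ≡ a′ → b ≡ b′ → c ≡ c′ → (a , b , c) ≡ (a′ , b′ , c′)
  ≡-triple refl refl refl = refl

  dot-e₁ : ∀ x₁ x₂ x₃ → dot (x₁ , x₂ , x₃) (+ 1 , + 0 , + 0) ≡ x₁
  dot-e₁ x₁ x₂ x₃ = solveExpr 3 (λ x₁ x₂ x₃ → E.dot′ (x₁ , x₂ , x₃) (Κ (+ 1) , Κ (+ 0) , Κ (+ 0)) ⊜ x₁) refl x₁ x₂ x₃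

  dot-e₂ : ∀ x₁ x₂ x₃ → dot (x₁ , x₂ , x₃) (+ 0 , + 1 , + 0) ≡ x₂
  dot-e₂ x₁ x₂ x₃ = solveExpr 3 (λ x₁ x₂ x₃ → E.dot′ (x₁ , x₂ , x₃) (Κ (+ 0) , Κ (+ 1) , Κ (+ 0)) ⊜ x₂) refl x₁ x₂ x₃

  dot-e₃ : ∀ x₁ x₂ x₃ → dot (x₁ , x₂ , x₃) (+ 0 , + 0 , + 1) ≡ x₃
  dot-e₃ x₁ x₂ x₃ = solveExpr 3 (λ x₁ x₂ x₃ → E.dot′ (x₁ , x₂ , x₃) (Κ (+ 0) , Κ (+ 0) , Κ (+ 1)) ⊜ x₃) refl x₁ x₂ x₃

  ≡-by-dot : ∀ x y → (∀ z → dot x z ≡ dot y z) → x ≡ y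
  ≡-by-dot (x₁ , x₂ , x₃) (y₁ , y₂ , y₃) x≈y = ≡-triple
    (trans (sym (dot-e₁ x₁ x₂ x₃)) (trans (x≈y (+ 1 , + 0 , + 0)) (dot-e₁ y₁ y₂ y₃)))
    (trans (sym (dot-e₂ x₁ x₂ x₃)) (trans (x≈y (+ 0 , + 1 , + 0)) (dot-e₂ y₁ y₂ y₃)))
    (trans (sym (dot-e₃ x₁ x₂ x₃)) (trans (x≈y (+ 0 , + 0 , + 1)) (dot-e₃ y₁ y₂ y₃)))

  dot-scaleˡ : ∀ k n w → dot (k ·₃ n) w ≡ k * dot n w
  dot-scaleˡ k (n₁ , n₂ , n₃) (w₁ , w₂ , w₃) =
    solveExpr 7 (λ k n₁ n₂ n₃ w₁ w₂ w₃ → let n = (n₁ , n₂ , n₃) ; w = (w₁ , w₂ , w₃) in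
      E.dot′ (k E.·₃′ n) w ⊜ k ⊗ E.dot′ n w) refl k n₁ n₂ n₃ w₁ w₂ w₃

  dot-decompose : ∀ n w a x b y →
    dot n w ≡ dot n (w -₃ ((a ·₃ x) +₃ (b ·₃ y))) + (a * dot n x + b * dot n y)
  dot-decompose (n₁ , n₂ , n₃) (w₁ , w₂ , w₃) a (x₁ , x₂ , x₃) b (y₁ , y₂ , y₃) =
    solveExpr 14 (λ n₁ n₂ n₃ w₁ w₂ w₃ a x₁ x₂ x₃ b y₁ y₂ y₃ →
      let n = (n₁ , n₂ , n₃) ; w = (w₁ , w₂ , w₃) ; x = (x₁ , x₂ , x₃) ; y = (y₁ , y₂ , y₃) in
      E.dot′ n w ⊜ (E.dot′ n (w E.-₃ ((a E.·₃′ x) E.+₃′ (b E.·₃′ y))) ⊕ (a ⊗ E.dot′ n x ⊕ b ⊗ E.dot′ n y)))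
      refl n₁ n₂ n₃ w₁ w₂ w₃ a x₁ x₂ x₃ b y₁ y₂ y₃

  dot-combination : ∀ a x b y c z w →
    a * dot x w - b * dot y w ≡ dot ((a ·₃ x) +₃ (((- b) ·₃ y) +₃ (c ·₃ z))) w - c * dot z w
  dot-combination a (x₁ , x₂ , x₃) b (y₁ , y₂ , y₃) c (z₁ , z₂ , z₃) (w₁ , w₂ , w₃) =
    solveExpr 15 (λ a x₁ x₂ x₃ b y₁ y₂ y₃ c z₁ z₂ z₃ w₁ w₂ w₃ →
      let x = (x₁ , x₂ , x₃) ; y = (y₁ , y₂ , y₃) ; z = (z₁ , z₂ , z₃) ; w = (w₁ , w₂ , w₃) in
      a ⊗ E.dot′ x w ⊕ ⊝ (b ⊗ E.dot′ y w)
        ⊜ (E.dot′ ((a E.·₃′ x) E.+₃′ (((⊝ b) E.·₃′ y) E.+₃′ (c E.·₃′ z))) w ⊕ ⊝ (c ⊗ E.dot′ z w)))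
      refl a x₁ x₂ x₃ b y₁ y₂ y₃ c z₁ z₂ z₃ w₁ w₂ w₃

  dot-linearʳ : ∀ l a x b y → dot l ((a ·₃ x) +₃ (b ·₃ y)) ≡ a * dot l x + b * dot l y
  dot-linearʳ (l₁ , l₂ , l₃) a (x₁ , x₂ , x₃) b (y₁ , y₂ , y₃) =
    solveExpr 11 (λ l₁ l₂ l₃ a x₁ x₂ x₃ b y₁ y₂ y₃ →
      let l = (l₁ , l₂ , l₃) ; x = (x₁ , x₂ , x₃) ; y = (y₁ , y₂ , y₃) in
      E.dot′ l ((a E.·₃′ x) E.+₃′ (b E.·₃′ y)) ⊜ (a ⊗ E.dot′ l x ⊕ b ⊗ E.dot′ l y))
      refl l₁ l₂ l₃ a x₁ x₂ x₃ b y₁ y₂ y₃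

  apply-linear : ∀ L a x b y → apply L ((a ·₃ x) +₃ (b ·₃ y)) ≡ (a ·₂ apply L x) +₂ (b ·₂ apply L y)
  apply-linear (l , m) a x b y = cong₂ _,_ (dot-linearʳ l a x b y) (dot-linearʳ m a x b y)

  det-cyclic : ∀ u v w → det u v w ≡ det v w u
  det-cyclic (u₁ , u₂ , u₃) (v₁ , v₂ , v₃) (w₁ , w₂ , w₃) =
    solveExpr 9 (λ u₁ u₂ u₃ v₁ v₂ v₃ w₁ w₂ w₃ → let u = (u₁ , u₂ , u₃) ; v = (v₁ , v₂ , v₃) ; w = (w₁ , w₂ , w₃) in
      E.det u v w ⊜ E.det v w u) refl u₁ u₂ u₃ v₁ v₂ v₃ w₁ w₂ w₃

  det-swap : ∀ u v w → det u v w ≡ - det u w v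
  det-swap (u₁ , u₂ , u₃) (v₁ , v₂ , v₃) (w₁ , w₂ , w₃) =
    solveExpr 9 (λ u₁ u₂ u₃ v₁ v₂ v₃ w₁ w₂ w₃ → let u = (u₁ , u₂ , u₃) ; v = (v₁ , v₂ , v₃) ; w = (w₁ , w₂ , w₃) in
      E.det u v w ⊜ ⊝ E.det u w v) refl u₁ u₂ u₃ v₁ v₂ v₃ w₁ w₂ w₃

  det-repeat₁ : ∀ u v → det u v u ≡ + 0
  det-repeat₁ (u₁ , u₂ , u₃) (v₁ , v₂ , v₃) =
    solveExpr 6 (λ u₁ u₂ u₃ v₁ v₂ v₃ → let u = (u₁ , u₂ , u₃) ; v = (v₁ , v₂ , v₃) in
      E.det u v u ⊜ Κ (+ 0)) refl u₁ u₂ u₃ v₁ v₂ v₃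

  det-repeat₂ : ∀ u v → det u v v ≡ + 0
  det-repeat₂ (u₁ , u₂ , u₃) (v₁ , v₂ , v₃) =
    solveExpr 6 (λ u₁ u₂ u₃ v₁ v₂ v₃ → let u = (u₁ , u₂ , u₃) ; v = (v₁ , v₂ , v₃) in
      E.det u v v ⊜ Κ (+ 0)) refl u₁ u₂ u₃ v₁ v₂ v₃

  cramer : ∀ r s q w →
    det r s q ·₃ w ≡ (dot r w ·₃ cross s q) +₃ ((dot s w ·₃ cross q r) +₃ (dot q w ·₃ cross r s))
  cramer (r₁ , r₂ , r₃) (s₁ , s₂ , s₃) (q₁ , q₂ , q₃) (w₁ , w₂ , w₃) = ≡-by-dot _ _ λ (z₁ , z₂ , z₃) →
    solveExpr 15 (λ r₁ r₂ r₃ s₁ s₂ s₃ q₁ q₂ q₃ w₁ w₂ w₃ z₁ z₂ z₃ →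
      let r = (r₁ , r₂ , r₃) ; s = (s₁ , s₂ , s₃) ; q = (q₁ , q₂ , q₃) ; w = (w₁ , w₂ , w₃) ; z = (z₁ , z₂ , z₃) in
      E.dot′ (E.det r s q E.·₃′ w) z
        ⊜ E.dot′ ((E.dot′ r w E.·₃′ E.cross s q) E.+₃′ ((E.dot′ s w E.·₃′ E.cross q r) E.+₃′ (E.dot′ q w E.·₃′ E.cross r s))) z)
      refl r₁ r₂ r₃ s₁ s₂ s₃ q₁ q₂ q₃ w₁ w₂ w₃ z₁ z₂ z₃

  det-cross-cross : ∀ a b c p q → det a b c * det p q a ≡ - det (cross a c) (cross a b) (cross p q)
  det-cross-cross (a₁ , a₂ , a₃) (b₁ , b₂ , b₃) (c₁ , c₂ , c₃) (p₁ , p₂ , p₃) (q₁ , q₂ , q₃) =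
    solveExpr 15 (λ a₁ a₂ a₃ b₁ b₂ b₃ c₁ c₂ c₃ p₁ p₂ p₃ q₁ q₂ q₃ →
      let a = (a₁ , a₂ , a₃) ; b = (b₁ , b₂ , b₃) ; c = (c₁ , c₂ , c₃) ; p = (p₁ , p₂ , p₃) ; q = (q₁ , q₂ , q₃) in
      E.det a b c ⊗ E.det p q a ⊜ ⊝ E.det (E.cross a c) (E.cross a b) (E.cross p q))
      refl a₁ a₂ a₃ b₁ b₂ b₃ c₁ c₂ c₃ p₁ p₂ p₃ q₁ q₂ q₃

  det-meet : ∀ P Q a b → det a b (meet P Q a b) ≡ + 0
  det-meet (p₁ , p₂ , p₃) (q₁ , q₂ , q₃) (a₁ , a₂ , a₃) (b₁ , b₂ , b₃) =
    solveExpr 12 (λ p₁ p₂ p₃ q₁ q₂ q₃ a₁ a₂ a₃ b₁ b₂ b₃ →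
      let P = (p₁ , p₂ , p₃) ; Q = (q₁ , q₂ , q₃) ; a = (a₁ , a₂ , a₃) ; b = (b₁ , b₂ , b₃) in
      E.det a b (E.meet P Q a b) ⊜ Κ (+ 0))
      refl p₁ p₂ p₃ q₁ q₂ q₃ a₁ a₂ a₃ b₁ b₂ b₃

  det-meet-third : ∀ P Q a b c → det c a (meet P Q a b) ≡ det a b c * det P Q a
  det-meet-third (p₁ , p₂ , p₃) (q₁ , q₂ , q₃) (a₁ , a₂ , a₃) (b₁ , b₂ , b₃) (c₁ , c₂ , c₃) =
    solveExpr 15 (λ p₁ p₂ p₃ q₁ q₂ q₃ a₁ a₂ a₃ b₁ b₂ b₃ c₁ c₂ c₃ →
      let P = (p₁ , p₂ , p₃) ; Q = (q₁ , q₂ , q₃) ; a = (a₁ , a₂ , a₃) ; b = (b₁ , b₂ , b₃) ; c = (c₁ , c₂ , c₃) in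
      E.det c a (E.meet P Q a b) ⊜ E.det a b c ⊗ E.det P Q a)
      refl p₁ p₂ p₃ q₁ q₂ q₃ a₁ a₂ a₃ b₁ b₂ b₃ c₁ c₂ c₃

  plücker₂ : ∀ a b c p q → det a b c * det p q b ≡ det a b p * det b c q - det b c p * det a b q
  plücker₂ (a₁ , a₂ , a₃) (b₁ , b₂ , b₃) (c₁ , c₂ , c₃) (p₁ , p₂ , p₃) (q₁ , q₂ , q₃) =
    solveExpr 15 (λ a₁ a₂ a₃ b₁ b₂ b₃ c₁ c₂ c₃ p₁ p₂ p₃ q₁ q₂ q₃ →
      let a = (a₁ , a₂ , a₃) ; b = (b₁ , b₂ , b₃) ; c = (c₁ , c₂ , c₃) ; p = (p₁ , p₂ , p₃) ; q = (q₁ , q₂ , q₃) in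
      E.det a b c ⊗ E.det p q b ⊜ (E.det a b p ⊗ E.det b c q ⊕ ⊝ (E.det b c p ⊗ E.det a b q)))
      refl a₁ a₂ a₃ b₁ b₂ b₃ c₁ c₂ c₃ p₁ p₂ p₃ q₁ q₂ q₃

  plücker₃ : ∀ a b c p q → det a b c * det p q c ≡ det a c p * det b c q - det b c p * det a c q
  plücker₃ (a₁ , a₂ , a₃) (b₁ , b₂ , b₃) (c₁ , c₂ , c₃) (p₁ , p₂ , p₃) (q₁ , q₂ , q₃) =
    solveExpr 15 (λ a₁ a₂ a₃ b₁ b₂ b₃ c₁ c₂ c₃ p₁ p₂ p₃ q₁ q₂ q₃ →
      let a = (a₁ , a₂ , a₃) ; b = (b₁ , b₂ , b₃) ; c = (c₁ , c₂ , c₃) ; p = (p₁ , p₂ , p₃) ; q = (q₁ , q₂ , q₃) in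
      E.det a b c ⊗ E.det p q c ⊜ (E.det a c p ⊗ E.det b c q ⊕ ⊝ (E.det b c p ⊗ E.det a c q)))
      refl a₁ a₂ a₃ b₁ b₂ b₃ c₁ c₂ c₃ p₁ p₂ p₃ q₁ q₂ q₃

  frameForm-b : ∀ a b c P Q → dot (frameForm a b c P Q) b ≡ + 0
  frameForm-b (a₁ , a₂ , a₃) (b₁ , b₂ , b₃) (c₁ , c₂ , c₃) (p₁ , p₂ , p₃) (q₁ , q₂ , q₃) =
    solveExpr 15 (λ a₁ a₂ a₃ b₁ b₂ b₃ c₁ c₂ c₃ p₁ p₂ p₃ q₁ q₂ q₃ →
      let a = (a₁ , a₂ , a₃) ; b = (b₁ , b₂ , b₃) ; c = (c₁ , c₂ , c₃) ; P = (p₁ , p₂ , p₃) ; Q = (q₁ , q₂ , q₃) in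
      E.dot′ (E.frameForm a b c P Q) b ⊜ Κ (+ 0))
      refl a₁ a₂ a₃ b₁ b₂ b₃ c₁ c₂ c₃ p₁ p₂ p₃ q₁ q₂ q₃

  frameForm-c : ∀ a b c P Q → dot (frameForm a b c P Q) c ≡ + 0
  frameForm-c (a₁ , a₂ , a₃) (b₁ , b₂ , b₃) (c₁ , c₂ , c₃) (p₁ , p₂ , p₃) (q₁ , q₂ , q₃) =
    solveExpr 15 (λ a₁ a₂ a₃ b₁ b₂ b₃ c₁ c₂ c₃ p₁ p₂ p₃ q₁ q₂ q₃ →
      let a = (a₁ , a₂ , a₃) ; b = (b₁ , b₂ , b₃) ; c = (c₁ , c₂ , c₃) ; P = (p₁ , p₂ , p₃) ; Q = (q₁ , q₂ , q₃) in
      E.dot′ (E.frameForm a b c P Q) c ⊜ Κ (+ 0))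
      refl a₁ a₂ a₃ b₁ b₂ b₃ c₁ c₂ c₃ p₁ p₂ p₃ q₁ q₂ q₃

  det₂-[1:0] : ∀ x y → det₂ (x , y) (+ 1 , + 0) ≡ - y
  det₂-[1:0] x y = solveExpr 2 (λ x y → E.det₂ (x , y) (Κ (+ 1) , Κ (+ 0)) ⊜ ⊝ y) refl x y

  det₂-[0:1] : ∀ x y → det₂ (x , y) (+ 0 , + 1) ≡ x
  det₂-[0:1] x y = solveExpr 2 (λ x y → E.det₂ (x , y) (Κ (+ 0) , Κ (+ 1)) ⊜ x) refl x y

  det₂-[1:1] : ∀ x y → det₂ (x , y) (+ 1 , + 1) ≡ x - y
  det₂-[1:1] x y = solveExpr 2 (λ x y → E.det₂ (x , y) (Κ (+ 1) , Κ (+ 1)) ⊜ (x ⊕ ⊝ y)) refl x y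

  -- u and v are the images of P and Q; the three combinations on the right are the conditions at
  -- X₁X₂ ∩ PQ, X₁X₃ ∩ PQ and X₂X₃ ∩ PQ, and the hypotheses are the relations plücker₂ and plücker₃
  three-point-elimination : ∀ A A′ B B′ C C′ D κ₂ κ₃ u v →
    D * κ₂ ≡ A * C′ - C * A′ → D * κ₃ ≡ B * C′ - C * B′ →
    D * det₂ u (κ₂ * B , κ₃ * A)
      ≡ (- (C * B)) * det₂ ((A′ ·₂ u) +₂ ((- A) ·₂ v)) (+ 1 , + 0)
        + (- (C * A)) * det₂ ((B′ ·₂ u) +₂ ((- B) ·₂ v)) (+ 0 , + 1)
        + A * B * det₂ ((C′ ·₂ u) +₂ ((- C) ·₂ v)) (+ 1 , + 1)
  three-point-elimination A A′ B B′ C C′ D κ₂ κ₃ (u₁ , u₂) (v₁ , v₂) Dκ₂ Dκ₃ = begin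
    D * (u₁ * (κ₃ * A) - u₂ * (κ₂ * B))
      ≡⟨ solve (D ∷ u₁ ∷ u₂ ∷ κ₂ ∷ κ₃ ∷ A ∷ B ∷ []) ⟩
    A * u₁ * (D * κ₃) - B * u₂ * (D * κ₂)
      ≡⟨ cong₂ (λ d₃ d₂ → A * u₁ * d₃ - B * u₂ * d₂) Dκ₃ Dκ₂ ⟩
    A * u₁ * (B * C′ - C * B′) - B * u₂ * (A * C′ - C * A′)
      ≡⟨ solveExpr 10 (λ A A′ B B′ C C′ u₁ u₂ v₁ v₂ → let u = (u₁ , u₂) ; v = (v₁ , v₂) in
           A ⊗ u₁ ⊗ (B ⊗ C′ ⊕ ⊝ (C ⊗ B′)) ⊕ ⊝ (B ⊗ u₂ ⊗ (A ⊗ C′ ⊕ ⊝ (C ⊗ A′)))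
             ⊜ (⊝ (C ⊗ B) ⊗ E.det₂ ((A′ E.·₂′ u) E.+₂ ((⊝ A) E.·₂′ v)) (Κ (+ 1) , Κ (+ 0))
                ⊕ ⊝ (C ⊗ A) ⊗ E.det₂ ((B′ E.·₂′ u) E.+₂ ((⊝ B) E.·₂′ v)) (Κ (+ 0) , Κ (+ 1))
                ⊕ A ⊗ B ⊗ E.det₂ ((C′ E.·₂′ u) E.+₂ ((⊝ C) E.·₂′ v)) (Κ (+ 1) , Κ (+ 1))))
           refl A A′ B B′ C C′ u₁ u₂ v₁ v₂ ⟩
    (- (C * B)) * det₂ ((A′ ·₂ (u₁ , u₂)) +₂ ((- A) ·₂ (v₁ , v₂))) (+ 1 , + 0)
      + (- (C * A)) * det₂ ((B′ ·₂ (u₁ , u₂)) +₂ ((- B) ·₂ (v₁ , v₂))) (+ 0 , + 1)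
      + A * B * det₂ ((C′ ·₂ (u₁ , u₂)) +₂ ((- C) ·₂ (v₁ , v₂))) (+ 1 , + 1) ∎
    where open ≡-Reasoning

  infix 4 _∣₃_ _∣₂_

  record _∣₃_ (m : ℤ) (v : V3) : Set where
    constructor divides₃
    field
      first : m ∣ proj₁ v
      second : m ∣ proj₁ (proj₂ v)
      third : m ∣ proj₂ (proj₂ v)

  record _∣₂_ (m : ℤ) (u : V2) : Set where
    constructor divides₂
    field
      first : m ∣ proj₁ u
      second : m ∣ proj₂ u

  module _ {m : ℤ} where

    ∣0 : m ∣ + 0
    ∣0 = divides (+ 0) refl

    ∣₃-zero : m ∣₃ zero₃
    ∣₃-zero = divides₃ ∣0 ∣0 ∣0

    ∣-by : ∀ {x y} → m ∣ y → x ≡ y → m ∣ x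
    ∣-by m∣y x≡y = subst (m ∣_) (sym x≡y) m∣y

    ∣₃-by : ∀ {x y} → m ∣₃ y → x ≡ y → m ∣₃ x
    ∣₃-by m∣y x≡y = subst (m ∣₃_) (sym x≡y) m∣y

    ∣₃? : ∀ v → Dec (m ∣₃ v)
    ∣₃? (a , b , c) with m ∣? a | m ∣? b | m ∣? c
    ... | yes m∣a | yes m∣b | yes m∣c = yes (divides₃ m∣a m∣b m∣c)
    ... | no m∤a | _ | _ = no λ { (divides₃ m∣a _ _) → m∤a m∣a }
    ... | _ | no m∤b | _ = no λ { (divides₃ _ m∣b _) → m∤b m∣b }
    ... | _ | _ | no m∤c = no λ { (divides₃ _ _ m∣c) → m∤c m∣c }

    ∣₃-from-difference : ∀ {x z} → m ∣₃ (x -₃ z) → m ∣₃ z → m ∣₃ x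
    ∣₃-from-difference {_ , _ , _} {_ , _ , _} (divides₃ a b c) (divides₃ a′ b′ c′) =
      divides₃ (∣m+n∣n⇒∣m a (∣m⇒∣-m a′)) (∣m+n∣n⇒∣m b (∣m⇒∣-m b′)) (∣m+n∣n⇒∣m c (∣m⇒∣-m c′))

    ∣₃-+ : ∀ {x y} → m ∣₃ x → m ∣₃ y → m ∣₃ (x +₃ y)
    ∣₃-+ (divides₃ a b c) (divides₃ a′ b′ c′) = divides₃ (∣m∣n⇒∣m+n a a′) (∣m∣n⇒∣m+n b b′) (∣m∣n⇒∣m+n c c′)

    ∣₃-scaleʳ : ∀ k {x} → m ∣₃ x → m ∣₃ (k ·₃ x)
    ∣₃-scaleʳ k (divides₃ a b c) = divides₃ (∣n⇒∣m*n k a) (∣n⇒∣m*n k b) (∣n⇒∣m*n k c)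

    ∣₃-scaleˡ : ∀ {k} → m ∣ k → ∀ x → m ∣₃ (k ·₃ x)
    ∣₃-scaleˡ m∣k (a , b , c) = divides₃ (∣m⇒∣m*n a m∣k) (∣m⇒∣m*n b m∣k) (∣m⇒∣m*n c m∣k)

    ∣₃-dotʳ : ∀ n {w} → m ∣₃ w → m ∣ dot n w
    ∣₃-dotʳ (n₁ , n₂ , n₃) (divides₃ a b c) =
      ∣m∣n⇒∣m+n (∣n⇒∣m*n n₁ a) (∣m∣n⇒∣m+n (∣n⇒∣m*n n₂ b) (∣n⇒∣m*n n₃ c))

    ∣₃-dotˡ : ∀ {n} → m ∣₃ n → ∀ w → m ∣ dot n w
    ∣₃-dotˡ (divides₃ a b c) (w₁ , w₂ , w₃) =
      ∣m∣n⇒∣m+n (∣m⇒∣m*n w₁ a) (∣m∣n⇒∣m+n (∣m⇒∣m*n w₂ b) (∣m⇒∣m*n w₃ c))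

    ∣₃-crossˡ : ∀ {u} → m ∣₃ u → ∀ e → m ∣₃ cross u e
    ∣₃-crossˡ (divides₃ a b c) (e₁ , e₂ , e₃) = divides₃
      (∣m∣n⇒∣m-n (∣m⇒∣m*n e₃ b) (∣m⇒∣m*n e₂ c))
      (∣m∣n⇒∣m-n (∣m⇒∣m*n e₁ c) (∣m⇒∣m*n e₃ a))
      (∣m∣n⇒∣m-n (∣m⇒∣m*n e₂ a) (∣m⇒∣m*n e₁ b))

  module Modulo (p : ℕ) where

    ≡0⇒∣ : ∀ x → x ≡ + 0 [mod p ] → + p ∣ x
    ≡0⇒∣ x = subst (+ p ∣_) (ℤ.+-identityʳ x) ∘ ∣ᵤ⇒∣

    ∣⇒≡0 : ∀ {x} → + p ∣ x → x ≡ + 0 [mod p ]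
    ∣⇒≡0 = ∣⇒∣ᵤ ∘ subst (+ p ∣_) (sym (ℤ.+-identityʳ _))

    Eq3⇒∣₃ : ∀ w z → Eq3 p w z → + p ∣₃ (w -₃ z)
    Eq3⇒∣₃ (_ , _ , _) (_ , _ , _) (e₁ , e₂ , e₃) = divides₃ (∣ᵤ⇒∣ e₁) (∣ᵤ⇒∣ e₂) (∣ᵤ⇒∣ e₃)

    ∣₃⇒Eq3 : ∀ w z → + p ∣₃ (w -₃ z) → Eq3 p w z
    ∣₃⇒Eq3 (_ , _ , _) (_ , _ , _) (divides₃ d₁ d₂ d₃) = ∣⇒∣ᵤ d₁ , ∣⇒∣ᵤ d₂ , ∣⇒∣ᵤ d₃

    Eq3-zero⇒∣₃ : ∀ w → Eq3 p w zero₃ → + p ∣₃ w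
    Eq3-zero⇒∣₃ (a , b , c) (e₁ , e₂ , e₃) = divides₃ (≡0⇒∣ a e₁) (≡0⇒∣ b e₂) (≡0⇒∣ c e₃)

    ∣₃⇒Eq3-zero : ∀ {w} → + p ∣₃ w → Eq3 p w zero₃
    ∣₃⇒Eq3-zero (divides₃ d₁ d₂ d₃) = ∣⇒≡0 d₁ , ∣⇒≡0 d₂ , ∣⇒≡0 d₃

    Eq2-zero⇒∣₂ : ∀ u → Eq2 p u zero₂ → + p ∣₂ u
    Eq2-zero⇒∣₂ (a , b) (e₁ , e₂) = divides₂ (≡0⇒∣ a e₁) (≡0⇒∣ b e₂)

    ∣₂⇒Eq2-zero : ∀ {u} → + p ∣₂ u → Eq2 p u zero₂
    ∣₂⇒Eq2-zero (divides₂ d₁ d₂) = ∣⇒≡0 d₁ , ∣⇒≡0 d₂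

    Eq3-refl : ∀ w → Eq3 p w w
    Eq3-refl (w₁ , w₂ , w₃) =
      ∣⇒∣ᵤ {+ p} (∣-by ∣0 (ℤ.+-inverseʳ w₁)) , ∣⇒∣ᵤ {+ p} (∣-by ∣0 (ℤ.+-inverseʳ w₂)) , ∣⇒∣ᵤ {+ p} (∣-by ∣0 (ℤ.+-inverseʳ w₃))

    unit-coordinate : ∀ v → ¬ + p ∣₃ v → ∃[ e ] ¬ + p ∣ dot v e
    unit-coordinate (a , b , c) v≢0 = choose (+ p ∣? a) (+ p ∣? b) (+ p ∣? c)
      where
      choose : Dec (+ p ∣ a) → Dec (+ p ∣ b) → Dec (+ p ∣ c) → ∃[ e ] ¬ + p ∣ dot (a , b , c) e
      choose (no p∤a) _ _ = (+ 1 , + 0 , + 0) , λ p∣ → p∤a (∣-by p∣ (sym (dot-e₁ a b c)))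
      choose _ (no p∤b) _ = (+ 0 , + 1 , + 0) , λ p∣ → p∤b (∣-by p∣ (sym (dot-e₂ a b c)))
      choose _ _ (no p∤c) = (+ 0 , + 0 , + 1) , λ p∣ → p∤c (∣-by p∣ (sym (dot-e₃ a b c)))
      choose (yes p∣a) (yes p∣b) (yes p∣c) = ⊥-elim (v≢0 (divides₃ p∣a p∣b p∣c))

    vanishes-on-line : ∀ n {x y} w → + p ∣ dot n x → + p ∣ dot n y → OnLine p x y w → + p ∣ dot n w
    vanishes-on-line n {x} {y} w p∣nx p∣ny (a , b , w≡ax+by) =
      ∣-by (∣m∣n⇒∣m+n (∣₃-dotʳ n (Eq3⇒∣₃ w ((a ·₃ x) +₃ (b ·₃ y)) w≡ax+by))
                      (∣m∣n⇒∣m+n (∣n⇒∣m*n a p∣nx) (∣n⇒∣m*n b p∣ny)))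
           (dot-decompose n w a x b y)

    onLine⇒det≡0 : ∀ x y w → OnLine p x y w → + p ∣ det x y w
    onLine⇒det≡0 x y w = vanishes-on-line (cross x y) w (∣-by ∣0 (det-repeat₁ x y)) (∣-by ∣0 (det-repeat₂ x y))

    x∈xy : ∀ x y → OnLine p x y x
    x∈xy x y = + 1 , + 0 , ∣₃⇒Eq3 x (((+ 1) ·₃ x) +₃ ((+ 0) ·₃ y)) (∣₃-by ∣₃-zero (trivial x y))
      where
      trivial : ∀ x y → x -₃ (((+ 1) ·₃ x) +₃ ((+ 0) ·₃ y)) ≡ zero₃
      trivial (x₁ , x₂ , x₃) (y₁ , y₂ , y₃) = ≡-by-dot _ _ λ (z₁ , z₂ , z₃) →
        solveExpr 9 (λ x₁ x₂ x₃ y₁ y₂ y₃ z₁ z₂ z₃ → let x = (x₁ , x₂ , x₃) ; y = (y₁ , y₂ , y₃) ; z = (z₁ , z₂ , z₃) in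
          E.dot′ (x E.-₃ ((Κ (+ 1) E.·₃′ x) E.+₃′ (Κ (+ 0) E.·₃′ y))) z ⊜ Κ (+ 0))
          refl x₁ x₂ x₃ y₁ y₂ y₃ z₁ z₂ z₃

    meet∈PQ : ∀ P Q a b → OnLine p P Q (meet P Q a b)
    meet∈PQ P Q a b = det a b Q , - det a b P , Eq3-refl (meet P Q a b)

    sameP1⇒det₂≡0 : ∀ u v → SameP1 p u v → + p ∣ det₂ u v
    sameP1⇒det₂≡0 (x , y) (r , s) (c , _ , x≡cr , y≡cs) =
      ∣-by (∣m∣n⇒∣m-n (∣m⇒∣m*n s (∣ᵤ⇒∣ {i = x - c * r} x≡cr)) (∣m⇒∣m*n r (∣ᵤ⇒∣ {i = y - c * s} y≡cs)))
           (solveExpr 5 (λ x y r s c → E.det₂ (x , y) (r , s) ⊜ ((x ⊕ ⊝ (c ⊗ r)) ⊗ s ⊕ ⊝ ((y ⊕ ⊝ (c ⊗ s)) ⊗ r)))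
              refl x y r s c)

    module Field (prime : Prime p) where

      ∤1 : ¬ + p ∣ + 1
      ∤1 p∣1 = ¬prime[1] (subst Prime (∣1⇒≡1 (∣⇒∣ᵤ p∣1)) prime)

      ∣-cancelˡ : ∀ {k x} → ¬ + p ∣ k → + p ∣ k * x → + p ∣ x
      ∣-cancelˡ {k} {x} p∤k p∣kx with euclidsLemma (abs k) (abs x) prime (subst (p ∣ℕ_) (ℤ.abs-* k x) (∣⇒∣ᵤ p∣kx))
      ... | inj₁ p∣k = ⊥-elim (p∤k (∣ᵤ⇒∣ p∣k))
      ... | inj₂ p∣x = ∣ᵤ⇒∣ p∣x

      ∤-* : ∀ {k x} → ¬ + p ∣ k → ¬ + p ∣ x → ¬ + p ∣ k * x
      ∤-* p∤k p∤x = p∤x ∘ ∣-cancelˡ p∤k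

      ∣₃-cancelˡ : ∀ {k w} → ¬ + p ∣ k → + p ∣₃ (k ·₃ w) → + p ∣₃ w
      ∣₃-cancelˡ {w = _ , _ , _} p∤k (divides₃ a b c) =
        divides₃ (∣-cancelˡ p∤k a) (∣-cancelˡ p∤k b) (∣-cancelˡ p∤k c)

      private
        coprime : ∀ {n} → ¬ p ∣ℕ n → Coprime p n
        coprime p∤n (d∣p , d∣n) with prime⇒irreducible prime d∣p
        ... | inj₁ d≡1 = d≡1
        ... | inj₂ refl = ⊥-elim (p∤n d∣n)

        pos-Bézout : ∀ a b c d → 1 ℕ.+ a ℕ.* b ≡ c ℕ.* d → + 1 + + a * + b ≡ + c * + d
        pos-Bézout a b c d eq = begin
          + 1 + + a * + b   ≡⟨ cong (_+_ (+ 1)) (sym (ℤ.pos-* a b)) ⟩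
          + (1 ℕ.+ a ℕ.* b) ≡⟨ cong +_ eq ⟩
          + (c ℕ.* d)       ≡⟨ ℤ.pos-* c d ⟩
          + c * + d         ∎
          where open ≡-Reasoning

        inverse-pos : ∀ n → ¬ + p ∣ + n → ∃[ t ] + p ∣ + n * t - + 1
        inverse-pos n p∤n with coprime-Bézout (coprime (p∤n ∘ ∣ᵤ⇒∣))
        ... | Bézout.+- x y eq = - + y , divides (- + x) (below (+ n) (+ y) (+ x) (+ p) (pos-Bézout y n x p eq))
          where
          below : ∀ N Y X P → + 1 + Y * N ≡ X * P → N * - Y - + 1 ≡ - X * P
          below N Y X P eq = begin
            N * - Y - + 1   ≡⟨ solve (N ∷ Y ∷ []) ⟩
            - (+ 1 + Y * N) ≡⟨ cong -_ eq ⟩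
            - (X * P)       ≡⟨ solve (X ∷ P ∷ []) ⟩
            - X * P         ∎
            where open ≡-Reasoning
        ... | Bézout.-+ x y eq = + y , divides (+ x) (above (+ n) (+ y) (+ x) (+ p) (pos-Bézout x p y n eq))
          where
          above : ∀ N Y X P → + 1 + X * P ≡ Y * N → N * Y - + 1 ≡ X * P
          above N Y X P eq = begin
            N * Y - + 1       ≡⟨ solve (N ∷ Y ∷ []) ⟩
            Y * N - + 1       ≡⟨ cong (_- + 1) (sym eq) ⟩
            + 1 + X * P - + 1 ≡⟨ solve (X ∷ P ∷ []) ⟩
            X * P             ∎
            where open ≡-Reasoning

      inverse : ∀ {c} → ¬ + p ∣ c → ∃[ t ] + p ∣ c * t - + 1
      inverse {+ n} p∤n = inverse-pos n p∤n
      inverse { -[1+ n ]} p∤c with inverse-pos (suc n) (p∤c ∘ ∣ᵤ⇒∣ ∘ ∣⇒∣ᵤ)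
      ... | t , p∣nt-1 = - t , ∣-by p∣nt-1 (negate-both (+ suc n) t)
        where
        negate-both : ∀ N t → - N * - t - + 1 ≡ N * t - + 1
        negate-both = solve-∀

      invertible-coordinate : ∀ v → ¬ + p ∣₃ v → ∃[ e ] ∃[ t ] + p ∣ dot v e * t - + 1
      invertible-coordinate v v≢0 = map₂ inverse (unit-coordinate v v≢0)

      independent-forms-kernel : ∀ r s q w → ¬ + p ∣ det r s q →
        + p ∣ dot r w → + p ∣ dot s w → + p ∣ dot q w → + p ∣₃ w
      independent-forms-kernel r s q w p∤det p∣rw p∣sw p∣qw = ∣₃-cancelˡ p∤det
        (∣₃-by (∣₃-+ (∣₃-scaleˡ p∣rw _) (∣₃-+ (∣₃-scaleˡ p∣sw _) (∣₃-scaleˡ p∣qw _))) (cramer r s q w))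

      det≡0⇒onLine : ∀ x y w → ¬ + p ∣₃ cross x y → + p ∣ det x y w → OnLine p x y w
      det≡0⇒onLine x y w x×y≢0 p∣xyw = from (invertible-coordinate (cross x y) x×y≢0)
        where
        coordinates : ∀ x y w e t → w -₃ (((t * det w y e) ·₃ x) +₃ ((t * det x w e) ·₃ y))
                                     ≡ ((- (det x y e * t - + 1)) ·₃ w) +₃ ((t * det x y w) ·₃ e)
        coordinates (x₁ , x₂ , x₃) (y₁ , y₂ , y₃) (w₁ , w₂ , w₃) (e₁ , e₂ , e₃) t = ≡-by-dot _ _ λ (z₁ , z₂ , z₃) →
          solveExpr 16 (λ x₁ x₂ x₃ y₁ y₂ y₃ w₁ w₂ w₃ e₁ e₂ e₃ t z₁ z₂ z₃ →
            let x = (x₁ , x₂ , x₃) ; y = (y₁ , y₂ , y₃) ; w = (w₁ , w₂ , w₃) ; e = (e₁ , e₂ , e₃) ; z = (z₁ , z₂ , z₃) in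
            E.dot′ (w E.-₃ (((t ⊗ E.det w y e) E.·₃′ x) E.+₃′ ((t ⊗ E.det x w e) E.·₃′ y))) z
              ⊜ E.dot′ (((⊝ (E.det x y e ⊗ t ⊕ ⊝ Κ (+ 1))) E.·₃′ w) E.+₃′ ((t ⊗ E.det x y w) E.·₃′ e)) z)
            refl x₁ x₂ x₃ y₁ y₂ y₃ w₁ w₂ w₃ e₁ e₂ e₃ t z₁ z₂ z₃
        from : ∃[ e ] ∃[ t ] + p ∣ det x y e * t - + 1 → OnLine p x y w
        from (e , t , p∣xye·t-1) = t * det w y e , t * det x w e , ∣₃⇒Eq3 w _
          (∣₃-by (∣₃-+ (∣₃-scaleˡ (∣m⇒∣-m p∣xye·t-1) w) (∣₃-scaleˡ (∣n⇒∣m*n t p∣xyw) e)) (coordinates x y w e t))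

      sameP2-intro : ∀ x y c → ¬ + p ∣₃ x → + p ∣₃ (x -₃ (c ·₃ y)) → SameP2 p x y
      sameP2-intro x y c x≢0 p∣x-cy = c , unit , ∣₃⇒Eq3 x (c ·₃ y) p∣x-cy
        where
        unit : Unit p c
        unit c≡0 = x≢0 (∣₃-from-difference p∣x-cy (∣₃-scaleˡ (≡0⇒∣ c c≡0) y))

      cross≡0⇒sameP2 : ∀ x y → ¬ + p ∣₃ x → ¬ + p ∣₃ y → + p ∣₃ cross x y → SameP2 p x y
      cross≡0⇒sameP2 x y x≢0 y≢0 p∣x×y = from (invertible-coordinate y y≢0)
        where
        decomposition : ∀ x y e t → x -₃ ((t * dot x e) ·₃ y)
                                    ≡ ((- (dot y e * t - + 1)) ·₃ x) +₃ ((- t) ·₃ cross (cross x y) e)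
        decomposition (x₁ , x₂ , x₃) (y₁ , y₂ , y₃) (e₁ , e₂ , e₃) t = ≡-by-dot _ _ λ (z₁ , z₂ , z₃) →
          solveExpr 13 (λ x₁ x₂ x₃ y₁ y₂ y₃ e₁ e₂ e₃ t z₁ z₂ z₃ →
            let x = (x₁ , x₂ , x₃) ; y = (y₁ , y₂ , y₃) ; e = (e₁ , e₂ , e₃) ; z = (z₁ , z₂ , z₃) in
            E.dot′ (x E.-₃ ((t ⊗ E.dot′ x e) E.·₃′ y)) z
              ⊜ E.dot′ (((⊝ (E.dot′ y e ⊗ t ⊕ ⊝ Κ (+ 1))) E.·₃′ x) E.+₃′ ((⊝ t) E.·₃′ E.cross (E.cross x y) e)) z)
            refl x₁ x₂ x₃ y₁ y₂ y₃ e₁ e₂ e₃ t z₁ z₂ z₃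
        from : ∃[ e ] ∃[ t ] + p ∣ dot y e * t - + 1 → SameP2 p x y
        from (e , t , p∣ye·t-1) = sameP2-intro x y (t * dot x e) x≢0
          (∣₃-by (∣₃-+ (∣₃-scaleˡ (∣m⇒∣-m p∣ye·t-1) x) (∣₃-scaleʳ (- t) (∣₃-crossˡ p∣x×y e))) (decomposition x y e t))

      det≡0⇒collinear : ∀ x y w → ¬ + p ∣₃ x → + p ∣ det x y w → Collinear p x y w
      det≡0⇒collinear x y w x≢0 p∣xyw = by-cases (∣₃? (cross x y))
        where
        through-w-relation : ∀ x y w a b →
          (a ·₃ x) +₃ ((b ·₃ y) +₃ ((- + 1) ·₃ w)) ≡ (- + 1) ·₃ (w -₃ ((a ·₃ x) +₃ (b ·₃ y)))
        through-w-relation (x₁ , x₂ , x₃) (y₁ , y₂ , y₃) (w₁ , w₂ , w₃) a b = ≡-by-dot _ _ λ (z₁ , z₂ , z₃) →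
          solveExpr 14 (λ x₁ x₂ x₃ y₁ y₂ y₃ w₁ w₂ w₃ a b z₁ z₂ z₃ →
            let x = (x₁ , x₂ , x₃) ; y = (y₁ , y₂ , y₃) ; w = (w₁ , w₂ , w₃) ; z = (z₁ , z₂ , z₃) in
            E.dot′ ((a E.·₃′ x) E.+₃′ ((b E.·₃′ y) E.+₃′ ((⊝ Κ (+ 1)) E.·₃′ w))) z
              ⊜ E.dot′ ((⊝ Κ (+ 1)) E.·₃′ (w E.-₃ ((a E.·₃′ x) E.+₃′ (b E.·₃′ y)))) z)
            refl x₁ x₂ x₃ y₁ y₂ y₃ w₁ w₂ w₃ a b z₁ z₂ z₃
        avoiding-w-relation : ∀ x y w e →
          (dot y e ·₃ x) +₃ (((- dot x e) ·₃ y) +₃ ((+ 0) ·₃ w)) ≡ (- + 1) ·₃ cross (cross x y) e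
        avoiding-w-relation (x₁ , x₂ , x₃) (y₁ , y₂ , y₃) (w₁ , w₂ , w₃) (e₁ , e₂ , e₃) = ≡-by-dot _ _ λ (z₁ , z₂ , z₃) →
          solveExpr 15 (λ x₁ x₂ x₃ y₁ y₂ y₃ w₁ w₂ w₃ e₁ e₂ e₃ z₁ z₂ z₃ →
            let x = (x₁ , x₂ , x₃) ; y = (y₁ , y₂ , y₃) ; w = (w₁ , w₂ , w₃) ; e = (e₁ , e₂ , e₃) ; z = (z₁ , z₂ , z₃) in
            E.dot′ ((E.dot′ y e E.·₃′ x) E.+₃′ (((⊝ E.dot′ x e) E.·₃′ y) E.+₃′ (Κ (+ 0) E.·₃′ w))) z
              ⊜ E.dot′ ((⊝ Κ (+ 1)) E.·₃′ E.cross (E.cross x y) e) z)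
            refl x₁ x₂ x₃ y₁ y₂ y₃ w₁ w₂ w₃ e₁ e₂ e₃ z₁ z₂ z₃
        through-w : OnLine p x y w → Collinear p x y w
        through-w (a , b , w≡ax+by) = a , b , - + 1 , (λ (_ , _ , -1≡0) → ∤1 (∣m⇒∣-m (≡0⇒∣ (- + 1) -1≡0))) ,
          ∣₃⇒Eq3-zero (∣₃-by (∣₃-scaleʳ (- + 1) (Eq3⇒∣₃ w _ w≡ax+by)) (through-w-relation x y w a b))
        avoiding-w : + p ∣₃ cross x y → ∃[ e ] ¬ + p ∣ dot x e → Collinear p x y w
        avoiding-w p∣x×y (e , p∤xe) = dot y e , - dot x e , + 0 ,
          (λ (_ , -xe≡0 , _) → p∤xe (∣-by (∣m⇒∣-m (≡0⇒∣ (- dot x e) -xe≡0)) (sym (ℤ.neg-involutive (dot x e))))) ,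
          ∣₃⇒Eq3-zero (∣₃-by (∣₃-scaleʳ (- + 1) (∣₃-crossˡ p∣x×y e)) (avoiding-w-relation x y w e))
        by-cases : Dec (+ p ∣₃ cross x y) → Collinear p x y w
        by-cases (no x×y≢0) = through-w (det≡0⇒onLine x y w x×y≢0 p∣xyw)
        by-cases (yes p∣x×y) = avoiding-w p∣x×y (unit-coordinate x x≢0)

      sameP1-intro : ∀ x y r s c → ¬ + p ∣₂ (x , y) → + p ∣ x - c * r → + p ∣ y - c * s → SameP1 p (x , y) (r , s)
      sameP1-intro x y r s c u≢0 p∣x-cr p∣y-cs = c , unit , ∣⇒∣ᵤ p∣x-cr , ∣⇒∣ᵤ p∣y-cs
        where
        unit : Unit p c
        unit c≡0 = u≢0 (divides₂ (∣m+n∣n⇒∣m p∣x-cr (∣m⇒∣-m (∣m⇒∣m*n r p∣c))) (∣m+n∣n⇒∣m p∣y-cs (∣m⇒∣-m (∣m⇒∣m*n s p∣c))))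
          where
          p∣c : + p ∣ c
          p∣c = ≡0⇒∣ c c≡0

      det₂≡0⇒sameP1 : ∀ u v → ¬ + p ∣₂ u → ¬ + p ∣₂ v → + p ∣ det₂ u v → SameP1 p u v
      det₂≡0⇒sameP1 (x , y) (r , s) u≢0 v≢0 p∣det = by-cases (+ p ∣? r) (+ p ∣? s)
        where
        p∣xs-yr : + p ∣ x * s - y * r
        p∣xs-yr = p∣det
        via-r : ∃[ t ] + p ∣ r * t - + 1 → SameP1 p (x , y) (r , s)
        via-r (t , p∣rt-1) = sameP1-intro x y r s (x * t) u≢0
          (∣-by (∣n⇒∣m*n (- x) p∣rt-1) (solve (x ∷ t ∷ r ∷ [])))
          (∣-by (∣m∣n⇒∣m+n (∣n⇒∣m*n (- y) p∣rt-1) (∣n⇒∣m*n (- t) p∣xs-yr)) (solve (x ∷ y ∷ r ∷ s ∷ t ∷ [])))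
        via-s : ∃[ t ] + p ∣ s * t - + 1 → SameP1 p (x , y) (r , s)
        via-s (t , p∣st-1) = sameP1-intro x y r s (y * t) u≢0
          (∣-by (∣m∣n⇒∣m+n (∣n⇒∣m*n (- x) p∣st-1) (∣n⇒∣m*n t p∣xs-yr)) (solve (x ∷ y ∷ r ∷ s ∷ t ∷ [])))
          (∣-by (∣n⇒∣m*n (- y) p∣st-1) (solve (y ∷ t ∷ s ∷ [])))
        by-cases : Dec (+ p ∣ r) → Dec (+ p ∣ s) → SameP1 p (x , y) (r , s)
        by-cases (no p∤r) _ = via-r (inverse p∤r)
        by-cases _ (no p∤s) = via-s (inverse p∤s)
        by-cases (yes p∣r) (yes p∣s) = ⊥-elim (v≢0 (divides₂ p∣r p∣s))

      meet∈ab : ∀ P Q a b c → ¬ + p ∣ det a b c → OnLine p a b (meet P Q a b)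
      meet∈ab P Q a b c abc≢0 =
        det≡0⇒onLine a b (meet P Q a b) (abc≢0 ∘ λ p∣a×b → ∣₃-dotˡ p∣a×b c) (∣-by ∣0 (det-meet P Q a b))

      meet≢0 : ∀ P Q a b c → ¬ + p ∣ det a b c → ¬ + p ∣ det P Q a → ¬ + p ∣₃ meet P Q a b
      meet≢0 P Q a b c abc≢0 PQa≢0 p∣meet =
        ∤-* abc≢0 PQa≢0 (∣-by (∣₃-dotʳ (cross c a) p∣meet) (sym (det-meet-third P Q a b c)))

      module Frame (X₁ X₂ X₃ P Q : V3) (P≢0 : ¬ + p ∣₃ P) (X₁X₂X₃≢0 : ¬ + p ∣ det X₁ X₂ X₃)
                   (X₁∉PQ : ¬ + p ∣ det P Q X₁) (X₂∉PQ : ¬ + p ∣ det P Q X₂) (X₃∉PQ : ¬ + p ∣ det P Q X₃) where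

        X₁X₃X₂≢0 : ¬ + p ∣ det X₁ X₃ X₂
        X₁X₃X₂≢0 p∣ = X₁X₂X₃≢0 (∣-by (∣m⇒∣-m p∣) (det-swap X₁ X₂ X₃))

        X₂X₃X₁≢0 : ¬ + p ∣ det X₂ X₃ X₁
        X₂X₃X₁≢0 p∣ = X₁X₂X₃≢0 (∣-by p∣ (det-cyclic X₁ X₂ X₃))

        L₀ : Mat23
        L₀ = (det P Q X₂ ·₃ cross X₁ X₃ , det P Q X₃ ·₃ cross X₁ X₂)

        row₁ row₂ : V3 → ℤ
        row₁ w = det P Q X₂ * det X₁ X₃ w
        row₂ w = det P Q X₃ * det X₁ X₂ w

        L₀-coordinates : ∀ w → apply L₀ w ≡ (row₁ w , row₂ w)
        L₀-coordinates w = cong₂ _,_ (dot-scaleˡ (det P Q X₂) (cross X₁ X₃) w) (dot-scaleˡ (det P Q X₃) (cross X₁ X₂) w)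

        L₀-det₂ : ∀ w t → det₂ (apply L₀ w) t ≡ det₂ (row₁ w , row₂ w) t
        L₀-det₂ w t = cong (λ u → det₂ u t) (L₀-coordinates w)

        kernel : ∀ w → + p ∣ det X₁ X₃ w → + p ∣ det X₁ X₂ w → + p ∣ det P Q w → + p ∣₃ w
        kernel w = independent-forms-kernel (cross X₁ X₃) (cross X₁ X₂) (cross P Q) w independent
          where
          independent : ¬ + p ∣ det (cross X₁ X₃) (cross X₁ X₂) (cross P Q)
          independent p∣ = ∤-* X₁X₂X₃≢0 X₁∉PQ (∣-by (∣m⇒∣-m p∣) (det-cross-cross X₁ X₂ X₃ P Q))

        L₀-kernel : ∀ w → OnLine p P Q w → + p ∣₂ apply L₀ w → + p ∣₃ w
        L₀-kernel w w∈PQ p∣L₀w = cancel (subst (+ p ∣₂_) (L₀-coordinates w) p∣L₀w)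
          where
          cancel : + p ∣₂ (row₁ w , row₂ w) → + p ∣₃ w
          cancel (divides₂ p∣f p∣g) = kernel w (∣-cancelˡ {x = det X₁ X₃ w} X₂∉PQ p∣f)
            (∣-cancelˡ {x = det X₁ X₂ w} X₃∉PQ p∣g) (onLine⇒det≡0 P Q w w∈PQ)

        L₀-injective : InjOnLine p L₀ P Q
        L₀-injective w w∈PQ L₀w≡0 = ∣₃⇒Eq3-zero (L₀-kernel w w∈PQ (Eq2-zero⇒∣₂ (apply L₀ w) L₀w≡0))

        L₀≢0 : ∀ w → ¬ + p ∣₃ w → OnLine p P Q w → ¬ + p ∣₂ apply L₀ w
        L₀≢0 w w≢0 w∈PQ = w≢0 ∘ L₀-kernel w w∈PQ

        L₀-sends : ∀ A B t → ¬ + p ∣₂ t →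
          (∀ w → OnLine p A B w → OnLine p P Q w → + p ∣ det₂ (apply L₀ w) t) → SendsMeet p L₀ A B P Q t
        L₀-sends A B t t≢0 vanishes w w≢0 w∈AB w∈PQ =
          det₂≡0⇒sameP1 (apply L₀ w) t (L₀≢0 w (w≢0 ∘ ∣₃⇒Eq3-zero) w∈PQ) t≢0 (vanishes w w∈AB w∈PQ)

        L₀-sends₁₂ : SendsMeet p L₀ X₁ X₂ P Q (+ 1 , + 0)
        L₀-sends₁₂ = L₀-sends X₁ X₂ (+ 1 , + 0) (λ { (divides₂ p∣1 _) → ∤1 p∣1 }) λ w w∈X₁X₂ _ →
          ∣-by (∣m⇒∣-m (∣n⇒∣m*n (det P Q X₃) (onLine⇒det≡0 X₁ X₂ w w∈X₁X₂)))
               (trans (L₀-det₂ w (+ 1 , + 0)) (det₂-[1:0] (row₁ w) (row₂ w)))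

        L₀-sends₁₃ : SendsMeet p L₀ X₁ X₃ P Q (+ 0 , + 1)
        L₀-sends₁₃ = L₀-sends X₁ X₃ (+ 0 , + 1) (λ { (divides₂ _ p∣1) → ∤1 p∣1 }) λ w w∈X₁X₃ _ →
          ∣-by (∣n⇒∣m*n (det P Q X₂) (onLine⇒det≡0 X₁ X₃ w w∈X₁X₃))
               (trans (L₀-det₂ w (+ 0 , + 1)) (det₂-[0:1] (row₁ w) (row₂ w)))

        L₀-sends₂₃ : SendsMeet p L₀ X₂ X₃ P Q (+ 1 , + 1)
        L₀-sends₂₃ = L₀-sends X₂ X₃ (+ 1 , + 1) (λ { (divides₂ p∣1 _) → ∤1 p∣1 }) λ w w∈X₂X₃ w∈PQ →
          ∣-by (∣m∣n⇒∣m-n (vanishes-on-line φ w φX₂ φX₃ w∈X₂X₃) (∣n⇒∣m*n (det X₁ X₂ X₃) (onLine⇒det≡0 P Q w w∈PQ)))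
               (trans (L₀-det₂ w (+ 1 , + 1)) (trans (det₂-[1:1] (row₁ w) (row₂ w))
                 (dot-combination (det P Q X₂) (cross X₁ X₃) (det P Q X₃) (cross X₁ X₂) (det X₁ X₂ X₃) (cross P Q) w)))
          where
          φ : V3
          φ = frameForm X₁ X₂ X₃ P Q
          φX₂ : + p ∣ dot φ X₂
          φX₂ = ∣-by ∣0 (frameForm-b X₁ X₂ X₃ P Q)
          φX₃ : + p ∣ dot φ X₃
          φX₃ = ∣-by ∣0 (frameForm-c X₁ X₂ X₃ P Q)

        L₀-identification : Identification p L₀ X₁ X₂ X₃ P Q
        L₀-identification = L₀-injective , L₀-sends₁₂ , L₀-sends₁₃ , L₀-sends₂₃

        L₀-unique : ∀ L → Identification p L X₁ X₂ X₃ P Q → SameP1 p (apply L P) (apply L₀ P)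
        L₀-unique L (L-injective , L-sends₁₂ , L-sends₁₃ , L-sends₂₃) =
          det₂≡0⇒sameP1 (apply L P) (apply L₀ P) LP≢0 (L₀≢0 P P≢0 (x∈xy P Q))
            (∣-cancelˡ X₁X₂X₃≢0 (∣-by (∣m∣n⇒∣m+n (∣m∣n⇒∣m+n (∣n⇒∣m*n (- (C * B)) at₁₂) (∣n⇒∣m*n (- (C * A)) at₁₃))
                                                 (∣n⇒∣m*n (A * B) at₂₃))
                                      elimination))
          where
          A A′ B B′ C C′ : ℤ
          A = det X₁ X₂ P
          A′ = det X₁ X₂ Q
          B = det X₁ X₃ P
          B′ = det X₁ X₃ Q
          C = det X₂ X₃ P
          C′ = det X₂ X₃ Q

          LP≢0 : ¬ + p ∣₂ apply L P
          LP≢0 p∣LP = P≢0 (Eq3-zero⇒∣₃ P (L-injective P (x∈xy P Q) (∣₂⇒Eq2-zero p∣LP)))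

          at-meet : ∀ a b c t → ¬ + p ∣ det a b c → ¬ + p ∣ det P Q a → SendsMeet p L a b P Q t →
            + p ∣ det₂ ((det a b Q ·₂ apply L P) +₂ ((- det a b P) ·₂ apply L Q)) t
          at-meet a b c t abc≢0 PQa≢0 sends =
            ∣-by (sameP1⇒det₂≡0 (apply L (meet P Q a b)) t
                   (sends (meet P Q a b) (meet≢0 P Q a b c abc≢0 PQa≢0 ∘ Eq3-zero⇒∣₃ (meet P Q a b))
                          (meet∈ab P Q a b c abc≢0) (meet∈PQ P Q a b)))
                 (sym (cong (λ u → det₂ u t) (apply-linear L (det a b Q) P (- det a b P) Q)))

          at₁₂ : + p ∣ det₂ ((A′ ·₂ apply L P) +₂ ((- A) ·₂ apply L Q)) (+ 1 , + 0)
          at₁₂ = at-meet X₁ X₂ X₃ (+ 1 , + 0) X₁X₂X₃≢0 X₁∉PQ L-sends₁₂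
          at₁₃ : + p ∣ det₂ ((B′ ·₂ apply L P) +₂ ((- B) ·₂ apply L Q)) (+ 0 , + 1)
          at₁₃ = at-meet X₁ X₃ X₂ (+ 0 , + 1) X₁X₃X₂≢0 X₁∉PQ L-sends₁₃
          at₂₃ : + p ∣ det₂ ((C′ ·₂ apply L P) +₂ ((- C) ·₂ apply L Q)) (+ 1 , + 1)
          at₂₃ = at-meet X₂ X₃ X₁ (+ 1 , + 1) X₂X₃X₁≢0 X₂∉PQ L-sends₂₃

          elimination : det X₁ X₂ X₃ * det₂ (apply L P) (apply L₀ P)
            ≡ (- (C * B)) * det₂ ((A′ ·₂ apply L P) +₂ ((- A) ·₂ apply L Q)) (+ 1 , + 0)
              + (- (C * A)) * det₂ ((B′ ·₂ apply L P) +₂ ((- B) ·₂ apply L Q)) (+ 0 , + 1)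
              + A * B * det₂ ((C′ ·₂ apply L P) +₂ ((- C) ·₂ apply L Q)) (+ 1 , + 1)
          elimination = trans (cong (λ v → det X₁ X₂ X₃ * det₂ (apply L P) v) (L₀-coordinates P))
            (three-point-elimination A A′ B B′ C C′ (det X₁ X₂ X₃) (det P Q X₂) (det P Q X₃) (apply L P) (apply L Q)
               (plücker₂ X₁ X₂ X₃ P Q) (plücker₃ X₁ X₂ X₃ P Q))

      module Configuration (X₁ X₂ X₃ X₅ X₆ : V3) (X₁≢0 : Nonzero3 p X₁) (X₅≢0 : Nonzero3 p X₅) (X₆≢0 : Nonzero3 p X₆)
        (X₁X₂X₃-noncollinear : ¬ Collinear p X₁ X₂ X₃) (X₅≠X₆ : ¬ SameP2 p X₅ X₆)
        (X₁∉ℓ : ¬ OnLine p X₅ X₆ X₁) (X₂∉ℓ : ¬ OnLine p X₅ X₆ X₂) (X₃∉ℓ : ¬ OnLine p X₅ X₆ X₃) where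

        private
          nonzero : ∀ w → Nonzero3 p w → ¬ + p ∣₃ w
          nonzero w w≢0 = w≢0 ∘ ∣₃⇒Eq3-zero

          X₅×X₆≢0 : ¬ + p ∣₃ cross X₅ X₆
          X₅×X₆≢0 = X₅≠X₆ ∘ cross≡0⇒sameP2 X₅ X₆ (nonzero X₅ X₅≢0) (nonzero X₆ X₆≢0)

          off-ℓ : ∀ X → ¬ OnLine p X₅ X₆ X → ¬ + p ∣ det X₅ X₆ X
          off-ℓ X X∉ℓ = X∉ℓ ∘ det≡0⇒onLine X₅ X₆ X X₅×X₆≢0

        open Frame X₁ X₂ X₃ X₅ X₆ (nonzero X₅ X₅≢0) (X₁X₂X₃-noncollinear ∘ det≡0⇒collinear X₁ X₂ X₃ (nonzero X₁ X₁≢0))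
          (off-ℓ X₁ X₁∉ℓ) (off-ℓ X₂ X₂∉ℓ) (off-ℓ X₃ X₃∉ℓ) public

module Heights where

  open import Data.Integer using (ℤ; ∣_∣) renaming (_*_ to _*ℤ_; _+_ to _+ℤ_; _-_ to _-ℤ_)
  import Data.Integer.Properties as ℤ
  open import Data.Nat using (ℕ; _≤_; _*_; _+_; _^_)
  open import Data.Nat.Properties using (≤-trans; ≤-reflexive; +-mono-≤; *-mono-≤; m≤m⊔n; m≤n⊔m; m≤n⇒m≤o⊔n)
  open import Data.Nat.Tactic.RingSolver using (solve-∀)
  open import Data.Product using (_×_; _,_)
  open import Relation.Binary.PropositionalEquality using (_≡_; sym; subst)
  open Geometry using (cross; det)

  Bounded : ℕ → V3 → Set
  Bounded M (a , b , c) = ∣ a ∣ ≤ M × ∣ b ∣ ≤ M × ∣ c ∣ ≤ M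

  absMax3-bounded : ∀ {M} v → absMax3 v ≤ M → Bounded M v
  absMax3-bounded (a , b , c) v≤M =
    ≤-trans (m≤m⊔n ∣ a ∣ _) v≤M ,
    ≤-trans (m≤n⇒m≤o⊔n ∣ a ∣ (m≤m⊔n ∣ b ∣ ∣ c ∣)) v≤M ,
    ≤-trans (m≤n⇒m≤o⊔n ∣ a ∣ (m≤n⊔m ∣ b ∣ ∣ c ∣)) v≤M

  absMax6-bounded : ∀ X₁ X₂ X₃ X₄ X₅ X₆ → let M = absMax6 X₁ X₂ X₃ X₄ X₅ X₆ in
    Bounded M X₁ × Bounded M X₂ × Bounded M X₃ × Bounded M X₅ × Bounded M X₆
  absMax6-bounded X₁ X₂ X₃ X₄ X₅ X₆ =
    absMax3-bounded X₁ (m≤m⊔n a₁ _) ,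
    absMax3-bounded X₂ (m≤n⇒m≤o⊔n a₁ (m≤m⊔n a₂ _)) ,
    absMax3-bounded X₃ (m≤n⇒m≤o⊔n a₁ (m≤n⇒m≤o⊔n a₂ (m≤m⊔n a₃ _))) ,
    absMax3-bounded X₅ (m≤n⇒m≤o⊔n a₁ (m≤n⇒m≤o⊔n a₂ (m≤n⇒m≤o⊔n a₃ (m≤n⇒m≤o⊔n a₄ (m≤m⊔n a₅ a₆))))) ,
    absMax3-bounded X₆ (m≤n⇒m≤o⊔n a₁ (m≤n⇒m≤o⊔n a₂ (m≤n⇒m≤o⊔n a₃ (m≤n⇒m≤o⊔n a₄ (m≤n⊔m a₅ a₆)))))
    where
    a₁ a₂ a₃ a₄ a₅ a₆ : ℕ
    a₁ = absMax3 X₁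
    a₂ = absMax3 X₂
    a₃ = absMax3 X₃
    a₄ = absMax3 X₄
    a₅ = absMax3 X₅
    a₆ = absMax3 X₆

  ∣*∣≤ : ∀ x y {A B} → ∣ x ∣ ≤ A → ∣ y ∣ ≤ B → ∣ x *ℤ y ∣ ≤ A * B
  ∣*∣≤ x y x≤A y≤B = subst (_≤ _) (sym (ℤ.abs-* x y)) (*-mono-≤ x≤A y≤B)

  ∣+∣≤ : ∀ x y {A B} → ∣ x ∣ ≤ A → ∣ y ∣ ≤ B → ∣ x +ℤ y ∣ ≤ A + B
  ∣+∣≤ x y x≤A y≤B = ≤-trans (ℤ.∣i+j∣≤∣i∣+∣j∣ x y) (+-mono-≤ x≤A y≤B)

  ∣-∣≤ : ∀ x y {A B} → ∣ x ∣ ≤ A → ∣ y ∣ ≤ B → ∣ x -ℤ y ∣ ≤ A + B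
  ∣-∣≤ x y x≤A y≤B = ≤-trans (ℤ.∣i-j∣≤∣i∣+∣j∣ x y) (+-mono-≤ x≤A y≤B)

  cross-bounded : ∀ {M} u v → Bounded M u → Bounded M v → Bounded (M * M + M * M) (cross u v)
  cross-bounded (a₁ , a₂ , a₃) (b₁ , b₂ , b₃) (a₁≤ , a₂≤ , a₃≤) (b₁≤ , b₂≤ , b₃≤) =
    ∣-∣≤ (a₂ *ℤ b₃) (a₃ *ℤ b₂) (∣*∣≤ a₂ b₃ a₂≤ b₃≤) (∣*∣≤ a₃ b₂ a₃≤ b₂≤) ,
    ∣-∣≤ (a₃ *ℤ b₁) (a₁ *ℤ b₃) (∣*∣≤ a₃ b₁ a₃≤ b₁≤) (∣*∣≤ a₁ b₃ a₁≤ b₃≤) ,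
    ∣-∣≤ (a₁ *ℤ b₂) (a₂ *ℤ b₁) (∣*∣≤ a₁ b₂ a₁≤ b₂≤) (∣*∣≤ a₂ b₁ a₂≤ b₁≤)

  ∣dot∣≤ : ∀ {A B} u v → Bounded A u → Bounded B v → ∣ dot u v ∣ ≤ A * B + (A * B + A * B)
  ∣dot∣≤ (a₁ , a₂ , a₃) (b₁ , b₂ , b₃) (a₁≤ , a₂≤ , a₃≤) (b₁≤ , b₂≤ , b₃≤) =
    ∣+∣≤ (a₁ *ℤ b₁) (a₂ *ℤ b₂ +ℤ a₃ *ℤ b₃) (∣*∣≤ a₁ b₁ a₁≤ b₁≤)
      (∣+∣≤ (a₂ *ℤ b₂) (a₃ *ℤ b₃) (∣*∣≤ a₂ b₂ a₂≤ b₂≤) (∣*∣≤ a₃ b₃ a₃≤ b₃≤))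

  ∣det∣≤ : ∀ {M} u v w → Bounded M u → Bounded M v → Bounded M w → ∣ det u v w ∣ ≤ 6 * M ^ 3
  ∣det∣≤ {M} u v w u≤ v≤ w≤ = ≤-trans (∣dot∣≤ (cross u v) w (cross-bounded u v u≤ v≤) w≤) (≤-reflexive (six M))
    where
    six : ∀ M → (M * M + M * M) * M + ((M * M + M * M) * M + (M * M + M * M) * M) ≡ 6 * (M * (M * (M * 1)))
    six = solve-∀

  ∣det*det∣≤ : ∀ {M} a b c d e f → Bounded M a → Bounded M b → Bounded M c → Bounded M d → Bounded M e → Bounded M f →
    ∣ det a b c *ℤ det d e f ∣ ≤ 36 * M ^ 6
  ∣det*det∣≤ {M} a b c d e f a≤ b≤ c≤ d≤ e≤ f≤ =
    ≤-trans (∣*∣≤ (det a b c) (det d e f) (∣det∣≤ a b c a≤ b≤ c≤) (∣det∣≤ d e f d≤ e≤ f≤)) (≤-reflexive (thirty-six M))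
    where
    thirty-six : ∀ M → 6 * (M * (M * (M * 1))) * (6 * (M * (M * (M * 1)))) ≡ 36 * (M * (M * (M * (M * (M * (M * 1))))))
    thirty-six = solve-∀

open Geometry using (module Modulo)
open Heights using (absMax6-bounded; ∣det*det∣≤)

open import Data.Integer using (ℤ; ∣_∣)
open import Data.Nat using (ℕ; _≤_; _*_; _^_)
open import Data.Nat.Primality using (Prime)
open import Data.Product using (_×_; _,_; Σ; ∃-syntax)
open import Relation.Nullary using (¬_)
open import Relation.Binary.PropositionalEquality using (subst)

-- Only X₁, X₂, X₃ and the line X₅X₆ enter.
lemma4p3 : ∃[ C ] (∀ (p : ℕ) → Prime p → (X₁ X₂ X₃ X₄ X₅ X₆ : V3)
    → Nonzero3 p X₁ → Nonzero3 p X₂ → Nonzero3 p X₃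
    → Nonzero3 p X₄ → Nonzero3 p X₅ → Nonzero3 p X₆
    → GeneralPosition p X₁ X₂ X₃ X₄
    → ¬ SameP2 p X₅ X₆
    → ¬ OnLine p X₅ X₆ X₁ → ¬ OnLine p X₅ X₆ X₂ → ¬ OnLine p X₅ X₆ X₃ → ¬ OnLine p X₅ X₆ X₄
    → Σ Mat23 (λ L → Identification p L X₁ X₂ X₃ X₅ X₆)
    × ∃[ r ] ∃[ s ] (∣ r ∣ ≤ C * absMax6 X₁ X₂ X₃ X₄ X₅ X₆ ^ 6
    × ∣ s ∣ ≤ C * absMax6 X₁ X₂ X₃ X₄ X₅ X₆ ^ 6
    × (∀ (L : Mat23) → Identification p L X₁ X₂ X₃ X₅ X₆ → SameP1 p (apply L X₅) (r , s))))
lemma4p3 = 36 , λ p prime X₁ X₂ X₃ X₄ X₅ X₆ X₁≢0 _ _ _ X₅≢0 X₆≢0 (X₁X₂X₃-noncollinear , _) X₅≠X₆ X₁∉ℓ X₂∉ℓ X₃∉ℓ _ →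
  let open Modulo.Field.Configuration p prime X₁ X₂ X₃ X₅ X₆ X₁≢0 X₅≢0 X₆≢0 X₁X₂X₃-noncollinear X₅≠X₆ X₁∉ℓ X₂∉ℓ X₃∉ℓ
      (X₁≤ , X₂≤ , X₃≤ , X₅≤ , X₆≤) = absMax6-bounded X₁ X₂ X₃ X₄ X₅ X₆
  in (L₀ , L₀-identification) , row₁ X₅ , row₂ X₅ ,
     ∣det*det∣≤ X₅ X₆ X₂ X₁ X₃ X₅ X₅≤ X₆≤ X₂≤ X₁≤ X₃≤ X₅≤ ,
     ∣det*det∣≤ X₅ X₆ X₃ X₁ X₂ X₅ X₅≤ X₆≤ X₃≤ X₁≤ X₂≤ X₅≤ ,
     λ L L-identification → subst (SameP1 p (apply L X₅)) (L₀-coordinates X₅) (L₀-unique L L-identification)
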